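{- $$\lim_{n\to\infty}\frac{w_2(P_{n+1})}{w_2(P_n)}=\phi,$$ where $\phi=\frac{1+\sqrt5}{2}$ is the golden ratio.
   Context: For a graph $G$, $w_2(G)$ denotes the number of unordered partitions of $V(G)$ into two nonempty dominating sets (a dominating set $S$ being one such that every vertex outside $S$ has a neighbor in $S$); equivalently, the number of weak 2-colorings of $G$ counted up to interchanging the two colors. $P_n$ is the path on $n$ vertices. -}

module Defs where

open import Data.Bool using (Bool; true; false; _∧_; _∨_; not; if_then_else_)
open import Data.Nat using (ℕ; zero; suc; _/_; NonZero)
open import Data.Fin using (Fin; toℕ)
open import Data.Vec using (Vec; []; _∷_; lookup; map)
open import Data.List using (List; []; _∷_; _++_; length; filter; allFin)
open import Data.Bool.ListAction using (all; any)
open import Data.Bool using (_≟_)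
import Data.List as L
open import Data.Product using (Σ; _×_)
open import Data.Sum using (_⊎_)
open import Relation.Nullary.Decidable using (⌊_⌋)
import Data.Nat as ℕ
open import Relation.Binary.PropositionalEquality using (_≡_)
open import Data.Rational as ℚ using (ℚ; 1ℚ; 0ℚ; _*_; _+_; _-_)
import Data.Integer as ℤ

Graph : ℕ → Set
Graph n = Fin n → Fin n → Bool

P : (n : ℕ) → Graph n
P n i j = ⌊ suc (toℕ i) ℕ.≟ toℕ j ⌋ ∨ ⌊ suc (toℕ j) ℕ.≟ toℕ i ⌋

Subset : ℕ → Set
Subset n = Vec Bool n

allSubsets : (n : ℕ) → List (Subset n)
allSubsets zero = [] ∷ []
allSubsets (suc n) = L.map (true ∷_) (allSubsets n) ++ L.map (false ∷_) (allSubsets n)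

complement : ∀ {n} → Subset n → Subset n
complement = map not

nonempty : ∀ {n} → Subset n → Bool
nonempty {n} S = any (lookup S) (allFin n)

dominating : ∀ {n} → Graph n → Subset n → Bool
dominating {n} G S =
  all (λ v → lookup S v ∨ any (λ u → G u v ∧ lookup S u) (allFin n)) (allFin n)

goodBlock : ∀ {n} → Graph n → Subset n → Bool
goodBlock G S = nonempty S ∧ nonempty (complement S)
              ∧ dominating G S ∧ dominating G (complement S)

-- w₂(G): number of UNORDERED partitions {S, V∖S} of V(G) into two nonempty
-- dominating sets.  Each such partition corresponds to exactly two blocks S,
-- so we count blocks and divide by 2.
w₂ : ∀ {n} → Graph n → ℕ
w₂ {n} G = length (filter (λ S → goodBlock G S ≟ true) (allSubsets n)) / 2

-- The golden ratio φ = (1+√5)/2 as a Dedekind cut on ℚ: φ is the positive root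
-- of x² = x + 1, so for rational q:
--   q < φ  iff  q < 1 or q² < q + 1,
--   φ < q  iff  0 < q and q + 1 < q².
_<φ : ℚ → Set
q <φ = (q ℚ.< 1ℚ) ⊎ (q * q ℚ.< q + 1ℚ)

φ<_ : ℚ → Set
φ< q = (0ℚ ℚ.< q) × (q + 1ℚ ℚ.< q * q)

∣_-φ∣<_ : ℚ → ℚ → Set
∣ q -φ∣< ε = ((q - ε) <φ) × (φ< (q + ε))

{-# OPTIONS --safe #-}
module Submission where

-- A partition of V(G) into two dominating sets is a 2-colouring in which every vertex has a
-- neighbour of the other colour.  On a path such colourings are built vertex by vertex, and
-- their number obeys the Fibonacci recursion: w₂(P_{n+1}) = F_n.  By Cassini's identity the
-- ratio r = F_{n+1}/F_n satisfies r² − r − 1 = ±1/F_n², and for r ≥ 1 a small value of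
-- r² − r − 1 forces r to be close to φ, the positive root of x² = x + 1.

module Fibonacci where

  open import Data.Nat using (ℕ; zero; suc; _+_; _≤_; _<_; z≤n; s≤s; NonZero; >-nonZero)
  open import Data.Nat.Properties using (≤-trans; m≤m+n; +-mono-≤; +-comm)
  open import Relation.Binary.PropositionalEquality using (subst)

  fib : ℕ → ℕ
  fib zero          = 0
  fib (suc zero)    = 1
  fib (suc (suc n)) = fib (suc n) + fib n

  fib-mono : ∀ n → fib (suc n) ≤ fib (suc (suc n))
  fib-mono n = m≤m+n (fib (suc n)) (fib n)

  0<fib[1+n] : ∀ n → 0 < fib (suc n)
  0<fib[1+n] zero    = s≤s z≤n
  0<fib[1+n] (suc n) = ≤-trans (0<fib[1+n] n) (fib-mono n)

  n≤fib[1+n] : ∀ n → n ≤ fib (suc n)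
  n≤fib[1+n] zero          = z≤n
  n≤fib[1+n] (suc zero)    = s≤s z≤n
  n≤fib[1+n] (suc (suc n)) =
    subst (_≤ fib (suc (suc (suc n)))) (+-comm (suc n) 1) (+-mono-≤ (n≤fib[1+n] (suc n)) (0<fib[1+n] n))

  fib[1+n]-nonZero : ∀ n → NonZero (fib (suc n))
  fib[1+n]-nonZero n = >-nonZero (0<fib[1+n] n)

module WeakColourings where

  open import Defs
  open import Data.Bool using (Bool; true; false; not; _∧_; _∨_; _xor_; _≟_)
  open import Data.Bool.Properties using (∧-identityʳ; ∨-identityʳ; ∧-zeroʳ; xor-comm)
  open import Data.Bool.ListAction using (all; any; and; or)
  open import Data.Fin using (Fin; zero; suc; toℕ)
  open import Data.List as List using (List; []; _∷_; _++_; length; filter; allFin)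
  open import Data.List.Properties using (map-tabulate; map-cong; filter-++; length-++; length-map; filter-≐)
  open import Data.Product using (_,_)
  open import Data.Nat as ℕ using (ℕ; zero; suc; _+_; _*_; _/_)
  open import Data.Nat.DivMod using (m*n/n≡m)
  open import Data.Nat.Properties using (+-comm; +-identityʳ; *-comm)
  open import Data.Vec using (Vec; []; _∷_; lookup)
  open import Data.Vec.Properties using (lookup-map)
  open import Function using (_∘_)
  open import Relation.Binary.PropositionalEquality
  open import Relation.Nullary using (Dec)
  open import Relation.Nullary.Decidable using (isYes≗does; does)
  open import Relation.Unary using (Decidable)
  open Fibonacci using (fib)

  module _ {A : Set} where

    any-cong : ∀ {p q : A → Bool} → (∀ x → p x ≡ q x) → ∀ xs → any p xs ≡ any q xs
    any-cong p≗q xs = cong or (map-cong p≗q xs)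

    all-cong : ∀ {p q : A → Bool} → (∀ x → p x ≡ q x) → ∀ xs → all p xs ≡ all q xs
    all-cong p≗q xs = cong and (map-cong p≗q xs)

    all-∧ : ∀ (p q : A → Bool) xs → (all p xs ∧ all q xs) ≡ all (λ x → p x ∧ q x) xs
    all-∧ p q [] = refl
    all-∧ p q (x ∷ xs) with p x | q x
    ... | true  | true  = all-∧ p q xs
    ... | true  | false = ∧-zeroʳ (all p xs)
    ... | false | _     = refl

    any-false : ∀ (xs : List A) → any (λ _ → false) xs ≡ false
    any-false [] = refl
    any-false (x ∷ xs) = any-false xs

  map-allFin-suc : ∀ {n} {B : Set} (p : Fin (suc n) → B) →
                   List.map p (allFin (suc n)) ≡ p zero ∷ List.map (p ∘ suc) (allFin n)
  map-allFin-suc p = cong (p zero ∷_) (trans (map-tabulate suc p) (sym (map-tabulate (λ i → i) (p ∘ suc))))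

  any-allFin-suc : ∀ {n} (p : Fin (suc n) → Bool) → any p (allFin (suc n)) ≡ (p zero ∨ any (p ∘ suc) (allFin n))
  any-allFin-suc p = cong or (map-allFin-suc p)

  all-allFin-suc : ∀ {n} (p : Fin (suc n) → Bool) → all p (allFin (suc n)) ≡ (p zero ∧ all (p ∘ suc) (allFin n))
  all-allFin-suc p = cong and (map-allFin-suc p)

  hasOppositeNeighbour : ∀ {n} → Graph n → Subset n → Fin n → Bool
  hasOppositeNeighbour {n} G S v = any (λ u → G u v ∧ (lookup S v xor lookup S u)) (allFin n)

  weaklyTwoColouring : ∀ {n} → Graph n → Subset n → Bool
  weaklyTwoColouring {n} G S = all (hasOppositeNeighbour G S) (allFin n)

  dominating-complement : ∀ {n} (G : Graph n) (S : Subset n) →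
                          (dominating G S ∧ dominating G (complement S)) ≡ weaklyTwoColouring G S
  dominating-complement {n} G S = trans (all-∧ _ _ (allFin n)) (all-cong pointwise (allFin n))
    where
    pointwise : ∀ v → ((lookup S v ∨ any (λ u → G u v ∧ lookup S u) (allFin n))
                      ∧ (lookup (complement S) v ∨ any (λ u → G u v ∧ lookup (complement S) u) (allFin n)))
                    ≡ any (λ u → G u v ∧ (lookup S v xor lookup S u)) (allFin n)
    pointwise v rewrite lookup-map v not S with lookup S v
    ... | true  = any-cong (λ u → cong (G u v ∧_) (lookup-map u not S)) (allFin n)
    ... | false = ∧-identityʳ _

  isZero : ∀ {n} → Fin n → Bool
  isZero zero    = true
  isZero (suc _) = false

  -- ⌊_⌋ does not compute on an undecided comparison, so we pass through isYes≗does.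
  path-shift : ∀ {n} (u v : Fin n) → P (suc n) (suc u) (suc v) ≡ P n u v
  path-shift u v = trans (cong₂ _∨_ (isYes≗does (suc (suc (toℕ u)) ℕ.≟ suc (toℕ v)))
                                    (isYes≗does (suc (suc (toℕ v)) ℕ.≟ suc (toℕ u))))
                         (sym (cong₂ _∨_ (isYes≗does (suc (toℕ u) ℕ.≟ toℕ v))
                                         (isYes≗does (suc (toℕ v) ℕ.≟ toℕ u))))

  path-from-zero : ∀ {n} (v : Fin n) → P (suc n) zero (suc v) ≡ isZero v
  path-from-zero zero    = refl
  path-from-zero (suc v) = refl

  -- Every vertex has a neighbour of the other colour; a = true exempts the first vertex, as if it had
  -- such a neighbour on its left.
  weakOnPath : ∀ {n} → Bool → Vec Bool n → Bool
  weakOnPath a []          = true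
  weakOnPath a (x ∷ [])    = a
  weakOnPath a (x ∷ y ∷ S) = (a ∨ (x xor y)) ∧ weakOnPath (x xor y) (y ∷ S)

  hasOppositeNeighbour-zero : ∀ {n} x y (S : Vec Bool n) →
                               hasOppositeNeighbour (P (suc (suc n))) (x ∷ y ∷ S) zero ≡ (x xor y)
  hasOppositeNeighbour-zero {n} x y S = begin
    hasOppositeNeighbour (P (suc (suc n))) (x ∷ y ∷ S) zero ≡⟨ any-allFin-suc neighbourOfFirst ⟩
    any (neighbourOfFirst ∘ suc) (allFin (suc n))            ≡⟨ any-allFin-suc (neighbourOfFirst ∘ suc) ⟩
    (x xor y) ∨ any (λ _ → false) (allFin n)                 ≡⟨ cong ((x xor y) ∨_) (any-false (allFin n)) ⟩
    (x xor y) ∨ false                                        ≡⟨ ∨-identityʳ (x xor y) ⟩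
    x xor y                                                  ∎
    where
    open ≡-Reasoning
    neighbourOfFirst : Fin (suc (suc n)) → Bool
    neighbourOfFirst u = P (suc (suc n)) u zero ∧ (x xor lookup (x ∷ y ∷ S) u)

  hasOppositeNeighbour-suc : ∀ {n} x (S : Vec Bool n) v →
                             hasOppositeNeighbour (P (suc n)) (x ∷ S) (suc v)
                             ≡ ((isZero v ∧ (lookup S v xor x)) ∨ hasOppositeNeighbour (P n) S v)
  hasOppositeNeighbour-suc {n} x S v =
    trans (any-allFin-suc (λ u → P (suc n) u (suc v) ∧ (lookup S v xor lookup (x ∷ S) u)))
          (cong₂ _∨_ (cong (_∧ (lookup S v xor x)) (path-from-zero v))
                     (any-cong (λ u → cong (_∧ (lookup S v xor lookup S u)) (path-shift u v)) (allFin n)))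

  weakOnPath-correct : ∀ {n} a (S : Vec Bool n) →
                       all (λ v → (isZero v ∧ a) ∨ hasOppositeNeighbour (P n) S v) (allFin n) ≡ weakOnPath a S
  weakOnPath-correct a []          = refl
  weakOnPath-correct a (x ∷ [])    = trans (∧-identityʳ _) (∨-identityʳ a)
  weakOnPath-correct {suc (suc n)} a (x ∷ y ∷ S) = begin
    all h (allFin (suc (suc n)))
      ≡⟨ all-allFin-suc h ⟩
    (a ∨ hasOppositeNeighbour (P (suc (suc n))) (x ∷ y ∷ S) zero) ∧ all (h ∘ suc) (allFin (suc n))
      ≡⟨ cong₂ _∧_ (cong (a ∨_) (hasOppositeNeighbour-zero x y S)) (all-cong shifted (allFin (suc n))) ⟩
    (a ∨ (x xor y))
      ∧ all (λ v → (isZero v ∧ (x xor y)) ∨ hasOppositeNeighbour (P (suc n)) (y ∷ S) v) (allFin (suc n))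
      ≡⟨ cong ((a ∨ (x xor y)) ∧_) (weakOnPath-correct (x xor y) (y ∷ S)) ⟩
    weakOnPath a (x ∷ y ∷ S)
      ∎
    where
    open ≡-Reasoning
    h : Fin (suc (suc n)) → Bool
    h v = (isZero v ∧ a) ∨ hasOppositeNeighbour (P (suc (suc n))) (x ∷ y ∷ S) v
    exempt : ∀ v → (isZero v ∧ (lookup (y ∷ S) v xor x)) ≡ (isZero v ∧ (x xor y))
    exempt zero    = xor-comm y x
    exempt (suc v) = refl
    shifted : ∀ v → h (suc v) ≡ ((isZero v ∧ (x xor y)) ∨ hasOppositeNeighbour (P (suc n)) (y ∷ S) v)
    shifted v = trans (hasOppositeNeighbour-suc x (y ∷ S) v) (cong (_∨ _) (exempt v))

  weaklyTwoColouring-path : ∀ {n} (S : Subset n) → weaklyTwoColouring (P n) S ≡ weakOnPath false S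
  weaklyTwoColouring-path {n} S =
    trans (all-cong (λ v → cong (_∨ hasOppositeNeighbour (P n) S v) (sym (∧-zeroʳ (isZero v)))) (allFin n))
          (weakOnPath-correct false S)

  weakOnPath-bicoloured : ∀ {n} (S : Subset (suc n)) →
                          (nonempty S ∧ nonempty (complement S) ∧ weakOnPath false S) ≡ weakOnPath false S
  weakOnPath-bicoloured (true  ∷ [])        = refl
  weakOnPath-bicoloured (false ∷ [])        = refl
  weakOnPath-bicoloured (true  ∷ true  ∷ S) = ∧-zeroʳ _
  weakOnPath-bicoloured (true  ∷ false ∷ S) = refl
  weakOnPath-bicoloured (false ∷ true  ∷ S) = refl
  weakOnPath-bicoloured S@(false ∷ false ∷ _) =
    trans (cong (nonempty S ∧_) (∧-zeroʳ (nonempty (complement S)))) (∧-zeroʳ (nonempty S))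

  goodBlock-path : ∀ {n} (S : Subset (suc n)) → goodBlock (P (suc n)) S ≡ weakOnPath false S
  goodBlock-path {n} S =
    trans (cong (λ b → nonempty S ∧ nonempty (complement S) ∧ b)
                (trans (dominating-complement (P (suc n)) S) (weaklyTwoColouring-path S)))
          (weakOnPath-bicoloured S)

  filter-map : ∀ {A B : Set} {Q : A → Set} (Q? : Decidable Q) (f : B → A) xs →
               filter Q? (List.map f xs) ≡ List.map f (filter (Q? ∘ f) xs)
  filter-map Q? f [] = refl
  filter-map Q? f (x ∷ xs) with does (Q? (f x))
  ... | true  = cong (f x ∷_) (filter-map Q? f xs)
  ... | false = filter-map Q? f xs

  count : ∀ n → (Subset n → Bool) → ℕ
  count n h = length (filter (λ S → h S ≟ true) (allSubsets n))

  count-cong : ∀ n {h h′ : Subset n → Bool} → (∀ S → h S ≡ h′ S) → count n h ≡ count n h′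
  count-cong n {h} {h′} h≗h′ =
    cong length (filter-≐ (λ S → h S ≟ true) (λ S → h′ S ≟ true)
                          ((λ {S} → trans (sym (h≗h′ S))) , (λ {S} → trans (h≗h′ S))) (allSubsets n))

  count-suc : ∀ n (h : Subset (suc n) → Bool) →
              count (suc n) h ≡ count n (h ∘ (true ∷_)) + count n (h ∘ (false ∷_))
  count-suc n h = begin
    length (filter h? (List.map (true ∷_) (allSubsets n) ++ List.map (false ∷_) (allSubsets n)))
      ≡⟨ cong length (filter-++ h? (List.map (true ∷_) (allSubsets n)) _) ⟩
    length (filter h? (List.map (true ∷_) (allSubsets n)) ++ filter h? (List.map (false ∷_) (allSubsets n)))
      ≡⟨ length-++ (filter h? (List.map (true ∷_) (allSubsets n))) ⟩
    length (filter h? (List.map (true ∷_) (allSubsets n))) + length (filter h? (List.map (false ∷_) (allSubsets n)))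
      ≡⟨ cong₂ _+_ (first-entry true) (first-entry false) ⟩
    count n (h ∘ (true ∷_)) + count n (h ∘ (false ∷_))
      ∎
    where
    open ≡-Reasoning
    h? : ∀ S → Dec (h S ≡ true)
    h? S = h S ≟ true
    first-entry : ∀ x → length (filter h? (List.map (x ∷_) (allSubsets n))) ≡ count n (h ∘ (x ∷_))
    first-entry x = trans (cong length (filter-map h? (x ∷_) (allSubsets n)))
                          (length-map {B = Subset (suc n)} (x ∷_) (filter (h? ∘ (x ∷_)) (allSubsets n)))

  count-false : ∀ n → count n (λ _ → false) ≡ 0
  count-false zero    = refl
  count-false (suc n) = trans (count-suc n (λ _ → false)) (cong₂ _+_ (count-false n) (count-false n))

  count-weakOnPath-exempt : ∀ n x → count n (λ S → weakOnPath true (x ∷ S)) ≡ fib (suc n)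
  count-weakOnPath        : ∀ n x → count n (λ S → weakOnPath false (x ∷ S)) ≡ fib n

  count-weakOnPath-exempt zero x = refl
  count-weakOnPath-exempt (suc n) true =
    trans (count-suc n _) (trans (cong₂ _+_ (count-weakOnPath n true) (count-weakOnPath-exempt n false))
                               (+-comm (fib n) (fib (suc n))))
  count-weakOnPath-exempt (suc n) false =
    trans (count-suc n _) (cong₂ _+_ (count-weakOnPath-exempt n true) (count-weakOnPath n false))

  count-weakOnPath zero x = refl
  count-weakOnPath (suc n) true =
    trans (count-suc n _) (cong₂ _+_ (count-false n) (count-weakOnPath-exempt n false))
  count-weakOnPath (suc n) false =
    trans (count-suc n _) (trans (cong₂ _+_ (count-weakOnPath-exempt n true) (count-false n))
                               (+-identityʳ (fib (suc n))))

  w₂-path : ∀ n → w₂ (P (suc n)) ≡ fib n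
  w₂-path n = begin
    count (suc n) (goodBlock (P (suc n))) / 2
      ≡⟨ cong (_/ 2) (count-cong (suc n) goodBlock-path) ⟩
    count (suc n) (weakOnPath false) / 2
      ≡⟨ cong (_/ 2) (trans (count-suc n (weakOnPath false))
                            (cong₂ _+_ (count-weakOnPath n true) (count-weakOnPath n false))) ⟩
    (fib n + fib n) / 2
      ≡⟨ cong (_/ 2) (trans (cong (fib n +_) (sym (+-identityʳ (fib n)))) (*-comm 2 (fib n))) ⟩
    fib n * 2 / 2
      ≡⟨ m*n/n≡m (fib n) 2 ⟩
    fib n
      ∎
    where open ≡-Reasoning

module GoldenRatio where

  open import Defs using (_<φ; φ<_; ∣_-φ∣<_)
  open import Algebra.Bundles using (CommutativeRing)
  open import Data.Integer as ℤ using (+_; +[1+_]; -[1+_])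
  import Data.Integer.Properties as ℤ
  import Data.Nat as ℕ
  import Data.Nat.Properties as ℕ
  open import Data.Product using (_×_; _,_; proj₁; proj₂; ∃-syntax)
  open import Data.Rational
    using (ℚ; mkℚ; 0ℚ; 1ℚ; _+_; _*_; _-_; -_; _<_; _≤_; _/_; toℚᵘ; nonNegative; positive; *<*)
  open import Data.Rational.Properties
  open import Data.Rational.Solver using (module +-*-Solver)
  import Data.Rational.Unnormalised as ℚᵘ
  import Data.Rational.Unnormalised.Properties as ℚᵘ
  open import Data.Sum using (_⊎_; inj₁; inj₂)
  open import Relation.Binary.PropositionalEquality
  open import Relation.Nullary using (yes; no)
  open import Algebra.Properties.Semiring.Mult (CommutativeRing.semiring +-*-commutativeRing)
    using (×-homo-1; ×-homo-+; ×1-homo-*) renaming (_×_ to _·_)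
  open +-*-Solver
  open Fibonacci

  p≤q⇒0≤q-p : ∀ {p q} → p ≤ q → 0ℚ ≤ q - p
  p≤q⇒0≤q-p {p} {q} p≤q = subst (_≤ q - p) (+-inverseʳ p) (+-monoˡ-≤ (- p) p≤q)

  p<q⇒0<q-p : ∀ {p q} → p < q → 0ℚ < q - p
  p<q⇒0<q-p {p} {q} p<q = subst (_< q - p) (+-inverseʳ p) (+-monoˡ-< (- p) p<q)

  0<q-p⇒p<q : ∀ {p q} → 0ℚ < q - p → p < q
  0<q-p⇒p<q {p} {q} 0<q-p =
    subst₂ _<_ (+-identityˡ p) (solve 2 (λ p q → (q :- p) :+ p := q) refl p q) (+-monoˡ-< p 0<q-p)

  0≤p⇒0≤q⇒0≤p*q : ∀ {p q} → 0ℚ ≤ p → 0ℚ ≤ q → 0ℚ ≤ p * q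
  0≤p⇒0≤q⇒0≤p*q {p} {q} 0≤p 0≤q =
    nonNegative⁻¹ _ {{nonNeg*nonNeg⇒nonNeg p {{nonNegative 0≤p}} q {{nonNegative 0≤q}}}}

  <-by-gap : ∀ {p q} x y → q - p ≡ x + y → 0ℚ < x → 0ℚ ≤ y → p < q
  <-by-gap x y q-p≡x+y 0<x 0≤y = 0<q-p⇒p<q (subst (0ℚ <_) (sym q-p≡x+y) (+-mono-<-≤ 0<x 0≤y))

  r-ε<φ : ∀ {r ε} → 0ℚ ≤ ε → 1ℚ ≤ r → r * r - r - 1ℚ < ε → (r - ε) <φ
  r-ε<φ {r} {ε} 0≤ε 1≤r D<ε with (r - ε) <? 1ℚ
  ... | yes r-ε<1 = inj₁ r-ε<1
  ... | no  r-ε≮1 = inj₂ (<-by-gap (ε - (r * r - r - 1ℚ)) (ε * ((r - 1ℚ) + ((r - ε) - 1ℚ))) gap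
                                   (p<q⇒0<q-p D<ε)
                                   (0≤p⇒0≤q⇒0≤p*q 0≤ε (+-mono-≤ (p≤q⇒0≤q-p 1≤r) (p≤q⇒0≤q-p (≮⇒≥ r-ε≮1)))))
    where
    gap : ((r - ε) + 1ℚ) - (r - ε) * (r - ε) ≡ (ε - (r * r - r - 1ℚ)) + ε * ((r - 1ℚ) + ((r - ε) - 1ℚ))
    gap = solve 2 (λ r ε → ((r :- ε) :+ con 1ℚ) :- (r :- ε) :* (r :- ε)
                  := (ε :- (r :* r :- r :- con 1ℚ)) :+ ε :* ((r :- con 1ℚ) :+ ((r :- ε) :- con 1ℚ))) refl r ε

  φ<r+ε : ∀ {r ε} → 0ℚ ≤ ε → 1ℚ ≤ r → - ε < r * r - r - 1ℚ → φ< (r + ε)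
  φ<r+ε {r} {ε} 0≤ε 1≤r -ε<D =
      +-mono-<-≤ (<-≤-trans (positive⁻¹ 1ℚ) 1≤r) 0≤ε
    , <-by-gap ((r * r - r - 1ℚ) - (- ε)) (ε * ((r - 1ℚ) + (r - 1ℚ) + ε)) gap
               (p<q⇒0<q-p -ε<D)
               (0≤p⇒0≤q⇒0≤p*q 0≤ε (+-mono-≤ (+-mono-≤ (p≤q⇒0≤q-p 1≤r) (p≤q⇒0≤q-p 1≤r)) 0≤ε))
    where
    gap : (r + ε) * (r + ε) - ((r + ε) + 1ℚ) ≡ ((r * r - r - 1ℚ) - (- ε)) + ε * ((r - 1ℚ) + (r - 1ℚ) + ε)
    gap = solve 2 (λ r ε → (r :+ ε) :* (r :+ ε) :- ((r :+ ε) :+ con 1ℚ)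
                  := ((r :* r :- r :- con 1ℚ) :- (:- ε)) :+ ε :* ((r :- con 1ℚ) :+ (r :- con 1ℚ) :+ ε)) refl r ε

  fromℕ : ℕ.ℕ → ℚ
  fromℕ n = n · 1ℚ

  fromℕ-+ : ∀ m n → fromℕ (m ℕ.+ n) ≡ fromℕ m + fromℕ n
  fromℕ-+ = ×-homo-+ 1ℚ

  fromℕ-* : ∀ m n → fromℕ (m ℕ.* n) ≡ fromℕ m * fromℕ n
  fromℕ-* = ×1-homo-*

  fromℕ-1 : fromℕ 1 ≡ 1ℚ
  fromℕ-1 = ×-homo-1 1ℚ

  fromℕ-nonNeg : ∀ n → 0ℚ ≤ fromℕ n
  fromℕ-nonNeg ℕ.zero    = ≤-refl
  fromℕ-nonNeg (ℕ.suc n) = +-mono-≤ (nonNegative⁻¹ 1ℚ) (fromℕ-nonNeg n)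

  fromℕ-mono-≤ : ∀ {m n} → m ℕ.≤ n → fromℕ m ≤ fromℕ n
  fromℕ-mono-≤ {n = n} ℕ.z≤n = fromℕ-nonNeg n
  fromℕ-mono-≤ (ℕ.s≤s m≤n)   = +-monoʳ-≤ 1ℚ (fromℕ-mono-≤ m≤n)

  toℚᵘ-fromℕ : ∀ n → toℚᵘ (fromℕ n) ℚᵘ.≃ ℚᵘ.mkℚᵘ (+ n) 0
  toℚᵘ-fromℕ ℕ.zero    = ℚᵘ.≃-refl
  toℚᵘ-fromℕ (ℕ.suc n) = begin
    toℚᵘ (1ℚ + fromℕ n)                 ≈⟨ toℚᵘ-homo-+ 1ℚ (fromℕ n) ⟩
    ℚᵘ.1ℚᵘ ℚᵘ.+ toℚᵘ (fromℕ n)          ≈⟨ ℚᵘ.+-congʳ ℚᵘ.1ℚᵘ (toℚᵘ-fromℕ n) ⟩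
    ℚᵘ.1ℚᵘ ℚᵘ.+ ℚᵘ.mkℚᵘ (+ n) 0         ≈⟨ ℚᵘ.*≡* 1+n≡1+n ⟩
    ℚᵘ.mkℚᵘ (+ ℕ.suc n) 0               ∎
    where
    open ℚᵘ.≃-Reasoning
    1+n≡1+n : (+ 1 ℤ.+ + n ℤ.* + 1) ℤ.* + 1 ≡ + ℕ.suc n ℤ.* + 1
    1+n≡1+n = trans (ℤ.*-identityʳ _) (trans (cong (ℤ._+_ (+ 1)) (ℤ.*-identityʳ (+ n))) (sym (ℤ.*-identityʳ _)))

  /-*-fromℕ : ∀ m n .{{_ : ℕ.NonZero n}} → ((+ m) / n) * fromℕ n ≡ fromℕ m
  /-*-fromℕ m n@(ℕ.suc k) = toℚᵘ-injective (begin
    toℚᵘ ((+ m / n) * fromℕ n)                ≈⟨ toℚᵘ-homo-* (+ m / n) (fromℕ n) ⟩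
    toℚᵘ (+ m / n) ℚᵘ.* toℚᵘ (fromℕ n)         ≈⟨ ℚᵘ.*-cong (toℚᵘ-fromℚᵘ (ℚᵘ.mkℚᵘ (+ m) k)) (toℚᵘ-fromℕ n) ⟩
    ℚᵘ.mkℚᵘ (+ m) k ℚᵘ.* ℚᵘ.mkℚᵘ (+ n) 0      ≈⟨ ℚᵘ.*≡* (ℤ.*-assoc (+ m) (+ n) (+ 1)) ⟩
    ℚᵘ.mkℚᵘ (+ m) 0                            ≈⟨ toℚᵘ-fromℕ m ⟨
    toℚᵘ (fromℕ m)                             ∎)
    where open ℚᵘ.≃-Reasoning

  _≡±1 : ℚ → Set
  c ≡±1 = (c ≡ 1ℚ) ⊎ (c ≡ - 1ℚ)

  ≡±1⇒-1≤c≤1 : ∀ {c} → c ≡±1 → (- 1ℚ ≤ c) × (c ≤ 1ℚ)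
  ≡±1⇒-1≤c≤1 (inj₁ refl) = <⇒≤ (*<* ℤ.-<+) , ≤-refl
  ≡±1⇒-1≤c≤1 (inj₂ refl) = ≤-refl , <⇒≤ (*<* ℤ.-<+)

  neg-≡±1 : ∀ {c} → c ≡±1 → (- c) ≡±1
  neg-≡±1 (inj₁ refl) = inj₂ refl
  neg-≡±1 (inj₂ refl) = inj₁ refl

  s*x≡±1⇒-ε<x<ε : ∀ {s x ε} → 0ℚ ≤ s → (s * x) ≡±1 → 1ℚ < ε * s → (- ε < x) × (x < ε)
  s*x≡±1⇒-ε<x<ε {s} {x} {ε} 0≤s sx≡±1 1<εs with ≡±1⇒-1≤c≤1 sx≡±1
  ... | -1≤sx , sx≤1 =
      *-cancelˡ-<-nonNeg s {{nonNegative 0≤s}} (begin-strict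
        s * - ε    ≡⟨ neg-distribʳ-* s ε ⟨
        - (s * ε)  ≡⟨ cong -_ (*-comm s ε) ⟩
        - (ε * s)  <⟨ neg-antimono-< 1<εs ⟩
        - 1ℚ       ≤⟨ -1≤sx ⟩
        s * x      ∎)
    , *-cancelˡ-<-nonNeg s {{nonNegative 0≤s}} (begin-strict
        s * x      ≤⟨ sx≤1 ⟩
        1ℚ         <⟨ 1<εs ⟩
        ε * s      ≡⟨ *-comm ε s ⟩
        s * ε      ∎)
    where open ≤-Reasoning

  cassini : ℚ → ℚ → ℚ
  cassini f g = g * g - g * f - f * f

  cassini-step : ∀ f g → cassini g (g + f) ≡ - cassini f g
  cassini-step = solve 2 (λ f g → (g :+ f) :* (g :+ f) :- (g :+ f) :* g :- g :* g
                                  := :- (g :* g :- g :* f :- f :* f)) refl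

  cassini-ratio-close : ∀ {f g r ε} → 0ℚ ≤ ε → 0ℚ ≤ f → f * r ≡ g → 1ℚ ≤ r →
                  cassini f g ≡±1 → 1ℚ < ε * (f * f) → ∣ r -φ∣< ε
  cassini-ratio-close {f} {g} {r} {ε} 0≤ε 0≤f fr≡g 1≤r cassini≡±1 1<εf² =
    r-ε<φ 0≤ε 1≤r (proj₂ D-small) , φ<r+ε 0≤ε 1≤r (proj₁ D-small)
    where
    f²D≡cassini : f * f * (r * r - r - 1ℚ) ≡ cassini f g
    f²D≡cassini = trans (solve 2 (λ f r → f :* f :* (r :* r :- r :- con 1ℚ)
                                          := (f :* r) :* (f :* r) :- (f :* r) :* f :- f :* f) refl f r)
                        (cong (λ t → t * t - t * f - f * f) fr≡g)
    D-small : (- ε < r * r - r - 1ℚ) × (r * r - r - 1ℚ < ε)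
    D-small = s*x≡±1⇒-ε<x<ε (0≤p⇒0≤q⇒0≤p*q 0≤f 0≤f) (subst _≡±1 (sym f²D≡cassini) cassini≡±1) 1<εf²

  -- For ε = (p+1)/(d+1), ε (d+1) = p + 1 ≥ 1, so N = 2 (d+1) gives ε N ≥ 2.
  archimedean : ∀ ε → 0ℚ < ε → ∃[ N ] 1ℚ < ε * fromℕ N
  archimedean (mkℚ (+ 0)      _ _) (*<* (ℤ.+<+ ()))
  archimedean (mkℚ -[1+ _ ]   _ _) (*<* ())
  archimedean ε@(mkℚ +[1+ p ] d _) _ = 2 ℕ.* ℕ.suc d , (begin-strict
    1ℚ                                <⟨ *<* (ℤ.+<+ (ℕ.s≤s (ℕ.s≤s ℕ.z≤n))) ⟩
    fromℕ 2                           ≤⟨ fromℕ-mono-≤ (ℕ.m≤m*n 2 (ℕ.suc p)) ⟩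
    fromℕ (2 ℕ.* ℕ.suc p)             ≡⟨ fromℕ-* 2 (ℕ.suc p) ⟩
    fromℕ 2 * fromℕ (ℕ.suc p)         ≡⟨ cong (fromℕ 2 *_) ε*[1+d]≡1+p ⟨
    fromℕ 2 * (ε * fromℕ (ℕ.suc d))   ≡⟨ solve 3 (λ e a b → a :* (e :* b) := e :* (a :* b))
                                                 refl ε (fromℕ 2) (fromℕ (ℕ.suc d)) ⟩
    ε * (fromℕ 2 * fromℕ (ℕ.suc d))   ≡⟨ cong (ε *_) (fromℕ-* 2 (ℕ.suc d)) ⟨
    ε * fromℕ (2 ℕ.* ℕ.suc d)         ∎)
    where
    open ≤-Reasoning
    ε*[1+d]≡1+p : ε * fromℕ (ℕ.suc d) ≡ fromℕ (ℕ.suc p)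
    ε*[1+d]≡1+p = trans (cong (_* fromℕ (ℕ.suc d)) (sym (↥p/↧p≡p ε))) (/-*-fromℕ (ℕ.suc p) (ℕ.suc d))

  fib-cassini : ∀ n → cassini (fromℕ (fib n)) (fromℕ (fib (ℕ.suc n))) ≡±1
  fib-cassini ℕ.zero    = inj₁ refl
  fib-cassini (ℕ.suc n) = subst _≡±1 (sym step) (neg-≡±1 (fib-cassini n))
    where
    step : cassini (fromℕ (fib (ℕ.suc n))) (fromℕ (fib (ℕ.suc (ℕ.suc n))))
           ≡ - cassini (fromℕ (fib n)) (fromℕ (fib (ℕ.suc n)))
    step = trans (cong (cassini (fromℕ (fib (ℕ.suc n)))) (fromℕ-+ (fib (ℕ.suc n)) (fib n)))
                 (cassini-step (fromℕ (fib n)) (fromℕ (fib (ℕ.suc n))))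

  fib-ratio-close : ∀ m {ε} → 0ℚ ≤ ε → 1ℚ < ε * fromℕ (fib (ℕ.suc m) ℕ.* fib (ℕ.suc m)) →
                    ∣ _/_ (+ fib (ℕ.suc (ℕ.suc m))) (fib (ℕ.suc m)) {{fib[1+n]-nonZero m}} -φ∣< ε
  fib-ratio-close m {ε} 0≤ε 1<εf² =
    cassini-ratio-close 0≤ε (fromℕ-nonNeg f) fr≡g 1≤r (fib-cassini (ℕ.suc m))
                  (subst (λ t → 1ℚ < ε * t) (fromℕ-* f f) 1<εf²)
    where
    instance _ = fib[1+n]-nonZero m
    f g : ℕ.ℕ
    f = fib (ℕ.suc m)
    g = fib (ℕ.suc (ℕ.suc m))
    fr≡g : fromℕ f * ((+ g) / f) ≡ fromℕ g
    fr≡g = trans (*-comm (fromℕ f) ((+ g) / f)) (/-*-fromℕ g f)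
    1≤f : 1ℚ ≤ fromℕ f
    1≤f = subst (_≤ fromℕ f) fromℕ-1 (fromℕ-mono-≤ (0<fib[1+n] m))
    1≤r : 1ℚ ≤ (+ g) / f
    1≤r = *-cancelˡ-≤-pos (fromℕ f) {{positive (<-≤-trans (positive⁻¹ 1ℚ) 1≤f)}}
            (subst₂ _≤_ (sym (*-identityʳ (fromℕ f))) (sym fr≡g) (fromℕ-mono-≤ (fib-mono m)))

open import Defs
open import Data.Nat using (ℕ; suc; _≤_; NonZero)
open import Data.Product using (Σ; ∃-syntax)
open import Data.Rational using (ℚ; 0ℚ; _<_; _/_)
open import Data.Integer using (+_)

open import Data.Nat.Properties using (≤-trans; m≤m*n)
open import Data.Nat using (s≤s)
open import Data.Product using (_,_)
open import Data.Rational using (1ℚ; _*_; nonNegative)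
open import Data.Rational.Properties using (<⇒≤; <-≤-trans; *-monoˡ-≤-nonNeg)
open import Relation.Binary.PropositionalEquality using (sym; subst₂)
open Fibonacci using (fib; fib[1+n]-nonZero; n≤fib[1+n])
open WeakColourings using (w₂-path)
open GoldenRatio using (fromℕ; fromℕ-mono-≤; archimedean; fib-ratio-close)
import Data.Nat as ℕ

w₂-ratio-close : ∀ {ε} N → 0ℚ < ε → 1ℚ < ε * fromℕ N → (n : ℕ) → suc (suc N) ≤ n →
                 Σ (NonZero (w₂ (P n))) λ nz → ∣ _/_ (+ w₂ (P (suc n))) (w₂ (P n)) {{nz}} -φ∣< ε
w₂-ratio-close {ε} N 0<ε 1<εN (suc (suc m)) (s≤s (s≤s N≤m)) =
  subst₂ (λ a b → Σ (NonZero b) λ nz → ∣ _/_ (+ a) b {{nz}} -φ∣< ε)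
         (sym (w₂-path (suc (suc m)))) (sym (w₂-path (suc m)))
         (fib[1+n]-nonZero m , fib-ratio-close m (<⇒≤ 0<ε) 1<εf²)
  where
  N≤f² : N ≤ fib (suc m) ℕ.* fib (suc m)
  N≤f² = ≤-trans N≤m (≤-trans (n≤fib[1+n] m) (m≤m*n (fib (suc m)) (fib (suc m)) {{fib[1+n]-nonZero m}}))
  1<εf² : 1ℚ < ε * fromℕ (fib (suc m) ℕ.* fib (suc m))
  1<εf² = <-≤-trans 1<εN (*-monoˡ-≤-nonNeg ε {{nonNegative (<⇒≤ 0<ε)}} (fromℕ-mono-≤ N≤f²))

mainTheorem6 : (ε : ℚ) → 0ℚ < ε → ∃[ N ] ((n : ℕ) → N ≤ n →
                 Σ (NonZero (w₂ (P n))) λ nz →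
                   ∣ _/_ (+ w₂ (P (suc n))) (w₂ (P n)) {{nz}} -φ∣< ε)
mainTheorem6 ε 0<ε = let N , 1<εN = archimedean ε 0<ε in suc (suc N) , w₂-ratio-close N 0<ε 1<εN
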